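{- Let $E$ be a finite set and let $\Psi:2^{E}\to 2^{E}$ satisfy $\Psi(X)\subseteq E\setminus X$ for every $X\subseteq E$. Assume $\Psi$ is isotone, i.e. for all $X\subseteq Y\subseteq E$ we have $\Psi(X)\cap(E\setminus Y)\subseteq\Psi(Y)$. Let $\mathcal{F}(\Psi)$ be the family of sets generated by $\Psi$ (see context). Then for every $X\in\mathcal{F}(\Psi)$ and every $x\in E\setminus X$: $X\cup\{x\}\in\mathcal{F}(\Psi)$ if and only if $x\in\Psi(X)$.
   Context: For an operator $\Psi:2^E\to 2^E$ with $\Psi(X)\subseteq E\setminus X$ for all $X$, the family $\mathcal{F}(\Psi)\subseteq 2^E$ consists of all sets $X\subseteq E$ for which there exist elements $x_1,\dots,x_m$ ($m\ge 0$) with $X=\{x_1,\dots,x_m\}$ and $x_i\in\Psi(\{x_1,\dots,x_{i-1}\})$ for every $1\le i\le m$ (in particular $\emptyset\in\mathcal{F}(\Psi)$). Equivalently, $\mathcal{F}(\Psi)$ is the smallest family containing $\emptyset$ and containing $X\cup\{x\}$ whenever $X$ is in it and $x\in\Psi(X)$. -}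

module Defs where

open import Data.Nat using (ℕ)
open import Data.Fin using (Fin)
open import Data.Fin.Subset using (Subset; _∈_; _∉_; _⊆_; _∪_; ⁅_⁆; ∁; _∩_; ⊥)
open import Data.Product using (_×_)

-- The ground set E is modelled as Fin n; subsets of E as Data.Fin.Subset n.

IsOperator : {n : ℕ} → (Subset n → Subset n) → Set
IsOperator {n} Ψ = (X : Subset n) → Ψ X ⊆ ∁ X

Isotone : {n : ℕ} → (Subset n → Subset n) → Set
Isotone {n} Ψ = (X Y : Subset n) → X ⊆ Y → (Ψ X ∩ ∁ Y) ⊆ Ψ Y

data 𝓕 {n : ℕ} (Ψ : Subset n → Subset n) : Subset n → Set where
  𝓕-∅    : 𝓕 Ψ ⊥
  𝓕-step : {X : Subset n} {x : Fin n} → 𝓕 Ψ X → x ∈ Ψ X → 𝓕 Ψ (X ∪ ⁅ x ⁆)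

{-# OPTIONS --safe #-}
module Submission where

-- Every element x of a generated set Z entered it at some stage W ⊆ Z with
-- x ∉ W and x ∈ Ψ W. For Z = X ∪ {x} with x ∉ X that stage lies inside X, and
-- isotonicity carries x ∈ Ψ W up to x ∈ Ψ X. The converse is the generating rule.

open import Defs
open import Data.Nat using (ℕ)
open import Data.Fin using (Fin)
open import Data.Fin.Subset using (Subset; _∈_; _∉_; _∪_; ⁅_⁆; _⊆_)
open import Data.Fin.Subset.Properties
open import Data.Empty using (⊥-elim)
open import Data.Product using (_×_; _,_; ∃)
open import Data.Sum using (inj₁; inj₂)
open import Relation.Binary.PropositionalEquality using (refl)

private
  variable
    n : ℕ
    x : Fin n
    W X Z : Subset n

⊆-∪⁅x⁆∧x∉⇒⊆ : W ⊆ X ∪ ⁅ x ⁆ → x ∉ W → W ⊆ X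
⊆-∪⁅x⁆∧x∉⇒⊆ {X = X} {x = x} W⊆X∪x x∉W {y} y∈W with x∈p∪q⁻ X ⁅ x ⁆ (W⊆X∪x y∈W)
... | inj₁ y∈X = y∈X
... | inj₂ y∈⁅x⁆ with x∈⁅y⁆⇒x≡y x y∈⁅x⁆
...   | refl = ⊥-elim (x∉W y∈W)

module _ (Ψ : Subset n → Subset n) where

  AddedBelow : Subset n → Fin n → Set
  AddedBelow Z x = ∃ λ W → W ⊆ Z × x ∉ W × x ∈ Ψ W

  addedBelow-mono : Z ⊆ X → AddedBelow Z x → AddedBelow X x
  addedBelow-mono Z⊆X (W , W⊆Z , x∉W , x∈ΨW) = W , ⊆-trans W⊆Z Z⊆X , x∉W , x∈ΨW

  ∈𝓕⇒addedBelow : IsOperator Ψ → 𝓕 Ψ Z → x ∈ Z → AddedBelow Z x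
  ∈𝓕⇒addedBelow op 𝓕-∅ x∈∅ = ⊥-elim (∉⊥ x∈∅)
  ∈𝓕⇒addedBelow op (𝓕-step {Y} {y} 𝓕Y y∈ΨY) x∈Y∪y with x∈p∪q⁻ Y ⁅ y ⁆ x∈Y∪y
  ... | inj₁ x∈Y = addedBelow-mono (p⊆p∪q ⁅ y ⁆) (∈𝓕⇒addedBelow op 𝓕Y x∈Y)
  ... | inj₂ x∈⁅y⁆ with x∈⁅y⁆⇒x≡y y x∈⁅y⁆
  ...   | refl = Y , p⊆p∪q ⁅ y ⁆ , x∈∁p⇒x∉p (op Y y∈ΨY) , y∈ΨY

  isotone⇒∈Ψ-mono : Isotone Ψ → W ⊆ X → x ∈ Ψ W → x ∉ X → x ∈ Ψ X
  isotone⇒∈Ψ-mono iso W⊆X x∈ΨW x∉X = iso _ _ W⊆X (x∈p∩q⁺ (x∈ΨW , x∉p⇒x∈∁p x∉X))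

  𝓕-extension⇒∈Ψ : IsOperator Ψ → Isotone Ψ → x ∉ X → 𝓕 Ψ (X ∪ ⁅ x ⁆) → x ∈ Ψ X
  𝓕-extension⇒∈Ψ {x = x} {X = X} op iso x∉X 𝓕X∪x
    with ∈𝓕⇒addedBelow op 𝓕X∪x (q⊆p∪q X ⁅ x ⁆ (x∈⁅x⁆ x))
  ... | W , W⊆X∪x , x∉W , x∈ΨW = isotone⇒∈Ψ-mono iso (⊆-∪⁅x⁆∧x∉⇒⊆ W⊆X∪x x∉W) x∈ΨW x∉X

lemma1 : (n : ℕ) (Ψ : Subset n → Subset n) → IsOperator Ψ → Isotone Ψ →
         (X : Subset n) → 𝓕 Ψ X → (x : Fin n) → x ∉ X →
         (𝓕 Ψ (X ∪ ⁅ x ⁆) → x ∈ Ψ X) × (x ∈ Ψ X → 𝓕 Ψ (X ∪ ⁅ x ⁆))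
lemma1 n Ψ op iso X 𝓕X x x∉X = 𝓕-extension⇒∈Ψ Ψ op iso x∉X , 𝓕-step 𝓕X
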